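{- Let $q\geq 64$ be a power of $2$ and let $\beta\in\mathbb{F}_q^*$. Define \[r_0(z):= (z^4-z)(z-\beta)(z^2 + z\beta^2 + z\beta + 1)(z^2 + z\beta^3 + z\beta^2 + z\beta + \beta^3 + \beta^2 + 1)(z\beta^3+\beta+1)\] and \[\Delta_0 :=\left\{z \in \mathbb{F}_q \ : \ \mathrm{Tr}_{q/2}\left(\frac{(z\beta^3 + z\beta^2 + z + \beta)(z+\beta)}{z^2\beta^4}\right)=0,\ r_0(z)\neq 0 \right\}.\] Then $\Delta_0\neq \emptyset$.
   Context: $\mathrm{Tr}_{q/2}$ denotes the absolute trace map from $\mathbb{F}_q$ to $\mathbb{F}_2$. -}

module Defs where

open import Data.Nat using (ℕ; zero; suc) renaming (_^_ to _^ℕ_)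
open import Data.Fin using (Fin)
open import Relation.Binary.PropositionalEquality using (_≡_)
open import Relation.Nullary using (¬_)
open import Function.Bundles using (_↔_)
open import Algebra.Structures using (IsCommutativeRing)

-- A finite field with exactly 2^n elements (equality is propositional).
-- The multiplicative inverse is a total function, meaningful on nonzero elements.
record FiniteField2 (n : ℕ) : Set₁ where
  infixl 6 _+_
  infixl 7 _*_
  field
    F        : Set
    _+_ _*_  : F → F → F
    -_       : F → F
    0# 1#    : F
    _⁻¹      : F → F
    isCommutativeRing : IsCommutativeRing _≡_ _+_ _*_ -_ 0# 1#
    nontrivial : ¬ (1# ≡ 0#)
    inverse    : ∀ x → ¬ (x ≡ 0#) → x * (x ⁻¹) ≡ 1#
    enumeration : Fin (2 ^ℕ n) ↔ F

  _-_ : F → F → F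
  x - y = x + (- y)

  _^_ : F → ℕ → F
  x ^ zero  = 1#
  x ^ suc k = x * (x ^ k)

  trSum : ℕ → F → F
  trSum zero    x = 0#
  trSum (suc i) x = trSum i x + x ^ (2 ^ℕ i)

  Tr : F → F
  Tr = trSum n

  r₀ : F → F → F
  r₀ β z =
    ((z ^ 4) - z) * (z - β)
    * ((z ^ 2) + z * (β ^ 2) + z * β + 1#)
    * ((z ^ 2) + z * (β ^ 3) + z * (β ^ 2) + z * β + (β ^ 3) + (β ^ 2) + 1#)
    * (z * (β ^ 3) + β + 1#)

  trArg : F → F → F
  trArg β z =
    ((z * (β ^ 3) + z * (β ^ 2) + z + β) * (z + β)) * (((z ^ 2) * (β ^ 4)) ⁻¹)

  InΔ₀ : F → F → Set
  InΔ₀ β z = (Tr (trArg β z) ≡ 0#) × ¬ (r₀ β z ≡ 0#)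
    where open import Data.Product using (_×_)

{-# OPTIONS --safe #-}
-- Substitute z = 1 / u with u = s² + s + C and C = (β³ + β² + 1) / β⁴. Then the argument of
-- the trace becomes w² + w with w = u / β + s, and Tr(w² + w) = w^q + w = 0. So every s with
-- u ≠ 0 and r₀(1/u) ≠ 0 gives an element of Δ₀. The excluded values of u are 0 and the
-- inverses of the at most 10 roots of r₀, and each value of u has at most two preimages s,
-- so at most 22 < 64 ≤ q elements s are excluded. Characteristic 2 is not assumed: it follows
-- from x^q = x applied to -1, as q is even.
module Submission where

open import Defs
open import Data.Nat as ℕ using (ℕ; zero; suc; _≤_; _<_; z≤n; s≤s) renaming (_^_ to _^ℕ_)
import Data.Nat.Properties as ℕ
open import Data.Fin using (Fin; zero; suc)
import Data.Fin.Properties as Fin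
open import Data.Product using (Σ; ∃; _,_; _×_)
open import Data.Sum using (_⊎_; inj₁; inj₂; [_,_]′)
open import Data.Empty using (⊥-elim)
open import Data.Maybe using (Maybe; just; nothing)
import Data.Maybe as Maybe
open import Data.List using (List; []; _∷_; _++_; length; lookup)
import Data.List as List
import Data.List.Properties as List
open import Data.List.Membership.Propositional using (_∈_)
open import Data.List.Membership.Propositional.Properties using (∈-++⁺ˡ; ∈-++⁺ʳ; ∈-map⁺)
import Data.List.Membership.DecPropositional as DecMembership
open import Data.List.Relation.Unary.Any using (here; there; index)
open import Data.List.Relation.Unary.Any.Properties using (lookup-index)
open import Relation.Binary.PropositionalEquality hiding ([_])
open import Relation.Binary.Definitions using (DecidableEquality)
open import Relation.Nullary using (¬_; Dec; yes; no)
open import Relation.Nullary.Decidable using (via-injection)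
open import Relation.Unary using (Decidable)
open import Function using (_∘_; _↔_; Inverse)
open import Function.Properties.Inverse using (↔-sym; ↔⇒↣)
open import Algebra.Bundles using (CommutativeRing; CommutativeSemiring)
open import Algebra.Structures using (IsCommutativeRing)
open import Data.Fin.Permutation using (Permutation; permutation)
import Algebra.Properties.CommutativeMonoid.Sum as MonoidSum
import Algebra.Properties.Ring as RingProperties
import Algebra.Properties.Semiring.Mult as SemiringMult
import Algebra.Solver.Ring.NaturalCoefficients as NaturalCoefficientsSolver
import Algebra.Solver.Ring.NaturalCoefficients.Default as DefaultSolver

module _ {A : Set} where

  AtMost : ℕ → (A → Set) → Set
  AtMost k P = Σ (List A) λ L → length L ≤ k × (∀ x → P x → x ∈ L)

  atMost-mono : ∀ {P Q : A → Set} {k} → (∀ x → P x → Q x) → AtMost k Q → AtMost k P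
  atMost-mono P⇒Q (L , |L|≤k , Q⊆L) = L , |L|≤k , λ x → Q⊆L x ∘ P⇒Q x

  atMost-≡ : ∀ y → AtMost 1 (_≡ y)
  atMost-≡ y = y ∷ [] , s≤s z≤n , λ x → here

  atMost-⊎ : ∀ {P Q : A → Set} {k m} → AtMost k P → AtMost m Q → AtMost (k ℕ.+ m) (λ x → P x ⊎ Q x)
  atMost-⊎ (L , |L|≤k , P⊆L) (M , |M|≤m , Q⊆M) =
    L ++ M ,
    ℕ.≤-trans (ℕ.≤-reflexive (List.length-++ L)) (ℕ.+-mono-≤ |L|≤k |M|≤m) ,
    λ { x (inj₁ p) → ∈-++⁺ˡ (P⊆L x p) ; x (inj₂ q) → ∈-++⁺ʳ L (Q⊆M x q) }

  atMost-image : ∀ {P : A → Set} {k} (f : A → A) → AtMost k P →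
                 AtMost k (λ y → ∃ λ x → P x × y ≡ f x)
  atMost-image f (L , |L|≤k , P⊆L) =
    List.map f L ,
    ℕ.≤-trans (ℕ.≤-reflexive (List.length-map f L)) |L|≤k ,
    λ { y (x , p , refl) → ∈-map⁺ f (P⊆L x p) }

  atMost-preimage : ∀ {P : A → Set} {k m} (f : A → A) → (∀ v → AtMost m (λ s → f s ≡ v)) →
                    AtMost k P → AtMost (k ℕ.* m) (P ∘ f)
  atMost-preimage {P} {k} {m} f fibre (L , |L|≤k , P⊆L) =
    let M , |M|≤ , f⁻¹L⊆M = preimage L
    in M , ℕ.≤-trans |M|≤ (ℕ.*-monoˡ-≤ m |L|≤k) , λ s p → f⁻¹L⊆M s (P⊆L (f s) p)
    where
    preimage : (L : List A) → Σ (List A) λ M → length M ≤ length L ℕ.* m × (∀ s → f s ∈ L → s ∈ M)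
    preimage [] = [] , z≤n , λ s ()
    preimage (v ∷ L) =
      let M , |M|≤ , f⁻¹L⊆M = preimage L
          V , |V|≤m , f⁻¹v⊆V = fibre v
      in V ++ M ,
         ℕ.≤-trans (ℕ.≤-reflexive (List.length-++ V)) (ℕ.+-mono-≤ |V|≤m |M|≤) ,
         λ { s (here p) → ∈-++⁺ˡ (f⁻¹v⊆V s p) ; s (there p) → ∈-++⁺ʳ V (f⁻¹L⊆M s p) }

module Enumerated {m : ℕ} {A : Set} (enum : Fin m ↔ A) where

  e : Fin m → A
  e = Inverse.to enum

  e⁻¹ : A → Fin m
  e⁻¹ = Inverse.from enum

  e∘e⁻¹ : ∀ x → e (e⁻¹ x) ≡ x
  e∘e⁻¹ x = Inverse.inverseˡ enum refl

  e⁻¹∘e : ∀ i → e⁻¹ (e i) ≡ i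
  e⁻¹∘e i = Inverse.inverseʳ enum refl

  _≟_ : DecidableEquality A
  _≟_ = via-injection (↔⇒↣ (↔-sym enum)) Fin._≟_

  open DecMembership _≟_ using (_∈?_)

  any? : ∀ {P : A → Set} → Decidable P → Dec (∃ P)
  any? {P} P? with Fin.any? (P? ∘ e)
  ... | yes (i , p) = yes (e i , p)
  ... | no ¬p = no λ { (x , p) → ¬p (e⁻¹ x , subst P (sym (e∘e⁻¹ x)) p) }

  atMost-2 : ∀ {P : A → Set} (f : A → A) → Decidable P →
             (∀ x y → P x → P y → y ≡ x ⊎ y ≡ f x) → AtMost 2 P
  atMost-2 f P? other with any? P?
  ... | yes (x , p) = x ∷ f x ∷ [] , ℕ.≤-refl ,
                      λ y q → [ here , there ∘ here ]′ (other x y p q)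
  ... | no ¬p = [] , z≤n , λ y q → ⊥-elim (¬p (y , q))

  atMost⇒∃¬ : ∀ {P : A → Set} {k} → AtMost k P → k < m → ∃ λ x → ¬ P x
  atMost⇒∃¬ {P} {k} (L , |L|≤k , P⊆L) k<m with Fin.all? (λ i → e i ∈? L)
  ... | no ¬all = let i , i∉L = Fin.¬∀⟶∃¬ m _ (λ i → e i ∈? L) ¬all
                  in e i , i∉L ∘ P⊆L (e i)
  ... | yes all with Fin.pigeonhole (ℕ.≤-<-trans |L|≤k k<m) (index ∘ all)
  ...   | i , j , i<j , same-index = ⊥-elim (Fin.<-irrefl i≡j i<j)
    where
    i≡j : i ≡ j
    i≡j = begin
      i                          ≡⟨ sym (e⁻¹∘e i) ⟩
      e⁻¹ (e i)                  ≡⟨ cong e⁻¹ (lookup-index (all i)) ⟩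
      e⁻¹ (lookup L (index (all i))) ≡⟨ cong (e⁻¹ ∘ lookup L) same-index ⟩
      e⁻¹ (lookup L (index (all j))) ≡⟨ cong e⁻¹ (sym (lookup-index (all j))) ⟩
      e⁻¹ (e j)                  ≡⟨ e⁻¹∘e j ⟩
      j                          ∎
      where open ≡-Reasoning

module FieldProperties {n : ℕ} (K : FiniteField2 n) where

  open FiniteField2 K
  open IsCommutativeRing isCommutativeRing
    using (+-assoc; *-assoc; *-comm; +-identityˡ; +-identityʳ; *-identityˡ; *-identityʳ;
           -‿inverseˡ; -‿inverseʳ; zeroˡ; zeroʳ; distribˡ)
  open Enumerated enumeration using (e; e⁻¹; _≟_; e∘e⁻¹; e⁻¹∘e; atMost-2; atMost⇒∃¬)
  open ≡-Reasoning

  commutativeRing : CommutativeRing _ _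
  commutativeRing = record { isCommutativeRing = isCommutativeRing }

  q : ℕ
  q = 2 ^ℕ n

  x⁻¹*x≡1 : ∀ {x} → x ≢ 0# → (x ⁻¹) * x ≡ 1#
  x⁻¹*x≡1 {x} x≢0 = trans (*-comm _ _) (inverse x x≢0)

  x⁻¹*[x*y]≡y : ∀ {x} → x ≢ 0# → ∀ y → (x ⁻¹) * (x * y) ≡ y
  x⁻¹*[x*y]≡y x≢0 y = trans (sym (*-assoc _ _ _)) (trans (cong (_* y) (x⁻¹*x≡1 x≢0)) (*-identityˡ y))

  x*[x⁻¹*y]≡y : ∀ {x} → x ≢ 0# → ∀ y → x * ((x ⁻¹) * y) ≡ y
  x*[x⁻¹*y]≡y {x} x≢0 y = trans (sym (*-assoc _ _ _)) (trans (cong (_* y) (inverse x x≢0)) (*-identityˡ y))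

  x*y≡0⇒x≡0⊎y≡0 : ∀ x y → x * y ≡ 0# → x ≡ 0# ⊎ y ≡ 0#
  x*y≡0⇒x≡0⊎y≡0 x y xy≡0 with x ≟ 0#
  ... | yes x≡0 = inj₁ x≡0
  ... | no x≢0 = inj₂ (begin
    y                ≡⟨ sym (x⁻¹*[x*y]≡y x≢0 y) ⟩
    (x ⁻¹) * (x * y) ≡⟨ cong ((x ⁻¹) *_) xy≡0 ⟩
    (x ⁻¹) * 0#      ≡⟨ zeroʳ _ ⟩
    0#               ∎)

  *-≢0 : ∀ {x y} → x ≢ 0# → y ≢ 0# → x * y ≢ 0#
  *-≢0 x≢0 y≢0 xy≡0 = [ x≢0 , y≢0 ]′ (x*y≡0⇒x≡0⊎y≡0 _ _ xy≡0)

  ^-≢0 : ∀ {x} → x ≢ 0# → ∀ k → x ^ k ≢ 0#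
  ^-≢0 x≢0 zero = nontrivial
  ^-≢0 x≢0 (suc k) = *-≢0 x≢0 (^-≢0 x≢0 k)

  ⁻¹-≢0 : ∀ {x} → x ≢ 0# → x ⁻¹ ≢ 0#
  ⁻¹-≢0 {x} x≢0 x⁻¹≡0 = nontrivial (begin
    1#          ≡⟨ sym (inverse x x≢0) ⟩
    x * (x ⁻¹)  ≡⟨ cong (x *_) x⁻¹≡0 ⟩
    x * 0#      ≡⟨ zeroʳ x ⟩
    0#          ∎)

  *-cancelʳ : ∀ {x y c} → c ≢ 0# → x * c ≡ y * c → x ≡ y
  *-cancelʳ {x} {y} {c} c≢0 xc≡yc = begin
    x                ≡⟨ sym (*-identityʳ x) ⟩
    x * 1#           ≡⟨ cong (x *_) (sym (inverse c c≢0)) ⟩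
    x * (c * (c ⁻¹)) ≡⟨ sym (*-assoc _ _ _) ⟩
    (x * c) * (c ⁻¹) ≡⟨ cong (_* (c ⁻¹)) xc≡yc ⟩
    (y * c) * (c ⁻¹) ≡⟨ *-assoc _ _ _ ⟩
    y * (c * (c ⁻¹)) ≡⟨ cong (y *_) (inverse c c≢0) ⟩
    y * 1#           ≡⟨ *-identityʳ y ⟩
    y                ∎

  ⁻¹-involutive : ∀ {x} → x ≢ 0# → (x ⁻¹) ⁻¹ ≡ x
  ⁻¹-involutive {x} x≢0 =
    *-cancelʳ (⁻¹-≢0 x≢0) (trans (x⁻¹*x≡1 (⁻¹-≢0 x≢0)) (sym (inverse x x≢0)))

  open MonoidSum (CommutativeRing.*-commutativeMonoid commutativeRing) using ()
    renaming (sum to ∏; sum-permute to ∏-permute; sum-cong-≗ to ∏-cong; ∑-distrib-+ to ∏-distrib-*)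

  ∏-≢0 : ∀ {m} (h : Fin m → F) → (∀ i → h i ≢ 0#) → ∏ h ≢ 0#
  ∏-≢0 {zero} h h≢0 = nontrivial
  ∏-≢0 {suc m} h h≢0 = *-≢0 (h≢0 zero) (∏-≢0 (h ∘ suc) (h≢0 ∘ suc))

  ∏-const : ∀ {m a} (h : Fin m → F) → (∀ i → h i ≡ a) → ∏ h ≡ a ^ m
  ∏-const {zero} h h≡a = refl
  ∏-const {suc m} h h≡a = cong₂ _*_ (h≡a zero) (∏-const (h ∘ suc) (h≡a ∘ suc))

  *-∏-except : ∀ {m a} (h : Fin m → F) (i₀ : Fin m) → h i₀ ≡ 1# →
               (∀ i → i ≢ i₀ → h i ≡ a) → a * ∏ h ≡ a ^ m
  *-∏-except {suc m} {a} h zero h₀≡1 h≡a = cong (a *_) (begin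
    h zero * ∏ (h ∘ suc) ≡⟨ cong₂ _*_ h₀≡1 (∏-const (h ∘ suc) (λ i → h≡a (suc i) λ ())) ⟩
    1# * (a ^ m)         ≡⟨ *-identityˡ _ ⟩
    a ^ m                ∎)
  *-∏-except {suc m} {a} h (suc j) hⱼ≡1 h≡a = begin
    a * (h zero * ∏ (h ∘ suc)) ≡⟨ cong (λ t → a * (t * ∏ (h ∘ suc))) (h≡a zero λ ()) ⟩
    a * (a * ∏ (h ∘ suc))      ≡⟨ cong (a *_) (*-∏-except (h ∘ suc) j hⱼ≡1 (λ i i≢j → h≡a (suc i) (i≢j ∘ Fin.suc-injective))) ⟩
    a * (a ^ m)                ∎

  orOne : F → F
  orOne x with x ≟ 0#
  ... | yes _ = 1#
  ... | no _ = x

  orOne-≢0 : ∀ x → orOne x ≢ 0#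
  orOne-≢0 x with x ≟ 0#
  ... | yes _ = nontrivial
  ... | no x≢0 = x≢0

  module _ {a : F} (a≢0 : a ≢ 0#) where

    private
      factor : F → F
      factor x with x ≟ 0#
      ... | yes _ = 1#
      ... | no _ = a

      factor-0 : factor 0# ≡ 1#
      factor-0 with 0# ≟ 0#
      ... | yes _ = refl
      ... | no 0≢0 = ⊥-elim (0≢0 refl)

      factor-≢0 : ∀ {x} → x ≢ 0# → factor x ≡ a
      factor-≢0 {x} x≢0 with x ≟ 0#
      ... | yes x≡0 = ⊥-elim (x≢0 x≡0)
      ... | no _ = refl

      orOne-* : ∀ x → orOne (a * x) ≡ factor x * orOne x
      orOne-* x with x ≟ 0# | (a * x) ≟ 0#
      ... | yes _   | yes _    = sym (*-identityˡ 1#)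
      ... | yes x≡0 | no ax≢0  = ⊥-elim (ax≢0 (trans (cong (a *_) x≡0) (zeroʳ a)))
      ... | no x≢0  | yes ax≡0 = ⊥-elim (*-≢0 a≢0 x≢0 ax≡0)
      ... | no _    | no _     = refl

      multiply-by-a : Permutation q q
      multiply-by-a = permutation (λ i → e⁻¹ (a * e i)) (λ j → e⁻¹ ((a ⁻¹) * e j))
        (λ j → trans (cong (λ t → e⁻¹ (a * t)) (e∘e⁻¹ _)) (trans (cong e⁻¹ (x*[x⁻¹*y]≡y a≢0 _)) (e⁻¹∘e j)))
        (λ i → trans (cong (λ t → e⁻¹ ((a ⁻¹) * t)) (e∘e⁻¹ _)) (trans (cong e⁻¹ (x⁻¹*[x*y]≡y a≢0 _)) (e⁻¹∘e i)))

      ∏orOne≡∏factor*∏orOne : ∏ (orOne ∘ e) ≡ ∏ (factor ∘ e) * ∏ (orOne ∘ e)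
      ∏orOne≡∏factor*∏orOne = begin
        ∏ (orOne ∘ e)                            ≡⟨ ∏-permute (orOne ∘ e) multiply-by-a ⟩
        ∏ (λ i → orOne (e (e⁻¹ (a * e i))))      ≡⟨ ∏-cong (λ i → trans (cong orOne (e∘e⁻¹ _)) (orOne-* (e i))) ⟩
        ∏ (λ i → factor (e i) * orOne (e i))     ≡⟨ ∏-distrib-* (factor ∘ e) (orOne ∘ e) ⟩
        ∏ (factor ∘ e) * ∏ (orOne ∘ e)           ∎

      a*∏factor≡a^q : a * ∏ (factor ∘ e) ≡ a ^ q
      a*∏factor≡a^q = *-∏-except (factor ∘ e) (e⁻¹ 0#) (trans (cong factor (e∘e⁻¹ 0#)) factor-0)
        (λ i i≢i₀ → factor-≢0 λ eᵢ≡0 → i≢i₀ (trans (sym (e⁻¹∘e i)) (cong e⁻¹ eᵢ≡0)))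

    -- ∏ orOne is the product of all nonzero elements. Multiplying by a permutes them, so
    -- the product is unchanged, while each of its q - 1 factors picks up an a.
    ≢0⇒x^q≡x : a ^ q ≡ a
    ≢0⇒x^q≡x = sym (*-cancelʳ (∏-≢0 (orOne ∘ e) (orOne-≢0 ∘ e)) (begin
      a * P                          ≡⟨ cong (a *_) ∏orOne≡∏factor*∏orOne ⟩
      a * (∏ (factor ∘ e) * P)       ≡⟨ sym (*-assoc _ _ _) ⟩
      (a * ∏ (factor ∘ e)) * P       ≡⟨ cong (_* P) a*∏factor≡a^q ⟩
      (a ^ q) * P                    ∎))
      where P = ∏ (orOne ∘ e)

  x^q≡x : ∀ x → x ^ q ≡ x
  x^q≡x x with x ≟ 0#
  ... | no x≢0 = ≢0⇒x^q≡x x≢0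
  ... | yes refl = 0^k≡0 q (ℕ.m^n>0 2 n)
    where
    0^k≡0 : ∀ k → 0 < k → 0# ^ k ≡ 0#
    0^k≡0 (suc k) _ = zeroˡ _

  q-even : ∃ λ k → q ≡ k ℕ.+ k
  q-even = even n enumeration
    where
    even : ∀ m → Fin (2 ^ℕ m) ↔ F → ∃ λ k → 2 ^ℕ m ≡ k ℕ.+ k
    even zero enum = ⊥-elim (nontrivial (begin
      1#                                 ≡⟨ sym (Inverse.inverseˡ enum refl) ⟩
      Inverse.to enum (Inverse.from enum 1#) ≡⟨ cong (Inverse.to enum) (Fin1-unique _ _) ⟩
      Inverse.to enum (Inverse.from enum 0#) ≡⟨ Inverse.inverseˡ enum refl ⟩
      0#                                 ∎))
      where
      Fin1-unique : (i j : Fin 1) → i ≡ j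
      Fin1-unique zero zero = refl
    even (suc m) _ = 2 ^ℕ m , cong (2 ^ℕ m ℕ.+_) (ℕ.+-identityʳ _)

  open RingProperties (CommutativeRing.ring commutativeRing) using (-1*x≈-x; -‿involutive)

  ^-even : ∀ {x} → x * x ≡ 1# → ∀ k → x ^ (k ℕ.+ k) ≡ 1#
  ^-even x*x≡1 zero = refl
  ^-even {x} x*x≡1 (suc k) = begin
    x * (x ^ (k ℕ.+ suc k))      ≡⟨ cong (λ t → x * (x ^ t)) (ℕ.+-suc k k) ⟩
    x * (x * (x ^ (k ℕ.+ k)))    ≡⟨ sym (*-assoc _ _ _) ⟩
    (x * x) * (x ^ (k ℕ.+ k))    ≡⟨ cong₂ _*_ x*x≡1 (^-even x*x≡1 k) ⟩
    1# * 1#                      ≡⟨ *-identityˡ _ ⟩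
    1#                           ∎

  -1≡1 : - 1# ≡ 1#
  -1≡1 = let k , q≡k+k = q-even in begin
    - 1#                  ≡⟨ sym (x^q≡x (- 1#)) ⟩
    (- 1#) ^ q            ≡⟨ cong ((- 1#) ^_) q≡k+k ⟩
    (- 1#) ^ (k ℕ.+ k)    ≡⟨ ^-even (trans (-1*x≈-x (- 1#)) (-‿involutive 1#)) k ⟩
    1#                    ∎

  1+1≡0 : 1# + 1# ≡ 0#
  1+1≡0 = trans (cong (1# +_) (sym -1≡1)) (-‿inverseʳ 1#)

  x+x≡0 : ∀ x → x + x ≡ 0#
  x+x≡0 x = begin
    x + x            ≡⟨ sym (cong₂ _+_ (*-identityʳ x) (*-identityʳ x)) ⟩
    x * 1# + x * 1#  ≡⟨ sym (distribˡ x 1# 1#) ⟩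
    x * (1# + 1#)    ≡⟨ cong (x *_) 1+1≡0 ⟩
    x * 0#           ≡⟨ zeroʳ x ⟩
    0#               ∎

  x+y≡0⇒x≡y : ∀ {x y} → x + y ≡ 0# → x ≡ y
  x+y≡0⇒x≡y {x} {y} x+y≡0 = begin
    x              ≡⟨ sym (+-identityʳ x) ⟩
    x + 0#         ≡⟨ cong (x +_) (sym (x+x≡0 y)) ⟩
    x + (y + y)    ≡⟨ sym (+-assoc _ _ _) ⟩
    (x + y) + y    ≡⟨ cong (_+ y) x+y≡0 ⟩
    0# + y         ≡⟨ +-identityˡ y ⟩
    y              ∎

  -x≡x : ∀ x → - x ≡ x
  -x≡x x = x+y≡0⇒x≡y (-‿inverseˡ x)

  commutativeSemiring : CommutativeSemiring _ _
  commutativeSemiring = CommutativeRing.commutativeSemiring commutativeRing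

  open SemiringMult (CommutativeSemiring.semiring commutativeSemiring) using () renaming (_×_ to _·_)

  2+i·1≡i·1 : ∀ i → suc (suc i) · 1# ≡ i · 1#
  2+i·1≡i·1 i = trans (sym (+-assoc 1# 1# (i · 1#))) (trans (cong (_+ (i · 1#)) 1+1≡0) (+-identityˡ _))

  -- The solver normalises numeral coefficients in ℕ; this lets it identify numerals mod 2.
  numeral-≟ : ∀ i j → Maybe (i · 1# ≡ j · 1#)
  numeral-≟ (suc (suc i)) j = Maybe.map (trans (2+i·1≡i·1 i)) (numeral-≟ i j)
  numeral-≟ i (suc (suc j)) = Maybe.map (λ p → trans p (sym (2+i·1≡i·1 j))) (numeral-≟ i j)
  numeral-≟ zero zero = just refl
  numeral-≟ (suc zero) (suc zero) = just refl
  numeral-≟ _ _ = nothing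

  x+[1+1]*y≡x : ∀ x y → x + (1# + 1#) * y ≡ x
  x+[1+1]*y≡x x y = trans (cong (λ t → x + t * y) 1+1≡0) (trans (cong (x +_) (zeroˡ y)) (+-identityʳ x))

  -- The mod-2 solver below does not cancel the even middle coefficients of this identity,
  -- so they are kept explicit as (1 + 1) · (z³ + z²).
  z⁴+z≡z[z+1][z²+z+1] : ∀ z → (z ^ 4) + z ≡ z * (z + 1#) * (z * z + 1# * z + 1#)
  z⁴+z≡z[z+1][z²+z+1] z = sym (trans
    (solve 1 (λ z → z :* (z :+ con 1) :* (z :* z :+ con 1 :* z :+ con 1)
                    := (z :^ 4) :+ z :+ (con 1 :+ con 1) :* ((z :^ 3) :+ (z :^ 2))) refl z)
    (x+[1+1]*y≡x _ _))
    where open DefaultSolver commutativeSemiring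

  open NaturalCoefficientsSolver commutativeSemiring numeral-≟ using (solve; _:+_; _:*_; _:^_; _:=_; con)

  ^-distribˡ-+-* : ∀ x i j → x ^ (i ℕ.+ j) ≡ (x ^ i) * (x ^ j)
  ^-distribˡ-+-* x zero j = sym (*-identityˡ _)
  ^-distribˡ-+-* x (suc i) j = trans (cong (x *_) (^-distribˡ-+-* x i j)) (sym (*-assoc _ _ _))

  x^2^[1+i]≡[x^2^i]² : ∀ i x → x ^ (2 ^ℕ suc i) ≡ (x ^ (2 ^ℕ i)) * (x ^ (2 ^ℕ i))
  x^2^[1+i]≡[x^2^i]² i x =
    trans (cong (λ t → x ^ (2 ^ℕ i ℕ.+ t)) (ℕ.+-identityʳ (2 ^ℕ i))) (^-distribˡ-+-* x (2 ^ℕ i) (2 ^ℕ i))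

  [x+y]²≡x²+y² : ∀ x y → (x + y) * (x + y) ≡ x * x + y * y
  [x+y]²≡x²+y² = solve 2 (λ x y → (x :+ y) :* (x :+ y) := x :* x :+ y :* y) refl

  frobenius-+ : ∀ i x y → (x + y) ^ (2 ^ℕ i) ≡ (x ^ (2 ^ℕ i)) + (y ^ (2 ^ℕ i))
  frobenius-+ zero x y = trans (*-identityʳ _) (sym (cong₂ _+_ (*-identityʳ x) (*-identityʳ y)))
  frobenius-+ (suc i) x y = begin
    (x + y) ^ (2 ^ℕ suc i)                          ≡⟨ x^2^[1+i]≡[x^2^i]² i (x + y) ⟩
    ((x + y) ^ (2 ^ℕ i)) * ((x + y) ^ (2 ^ℕ i))     ≡⟨ cong (λ t → t * t) (frobenius-+ i x y) ⟩
    (xᵢ + yᵢ) * (xᵢ + yᵢ)                           ≡⟨ [x+y]²≡x²+y² xᵢ yᵢ ⟩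
    xᵢ * xᵢ + yᵢ * yᵢ                               ≡⟨ sym (cong₂ _+_ (x^2^[1+i]≡[x^2^i]² i x) (x^2^[1+i]≡[x^2^i]² i y)) ⟩
    (x ^ (2 ^ℕ suc i)) + (y ^ (2 ^ℕ suc i))         ∎
    where
    xᵢ = x ^ (2 ^ℕ i)
    yᵢ = y ^ (2 ^ℕ i)

  [x²]^2^i≡x^2^[1+i] : ∀ i x → (x ^ 2) ^ (2 ^ℕ i) ≡ x ^ (2 ^ℕ suc i)
  [x²]^2^i≡x^2^[1+i] zero x = *-identityʳ _
  [x²]^2^i≡x^2^[1+i] (suc i) x = begin
    (x ^ 2) ^ (2 ^ℕ suc i)                          ≡⟨ x^2^[1+i]≡[x^2^i]² i (x ^ 2) ⟩
    ((x ^ 2) ^ (2 ^ℕ i)) * ((x ^ 2) ^ (2 ^ℕ i))     ≡⟨ cong (λ t → t * t) ([x²]^2^i≡x^2^[1+i] i x) ⟩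
    (x ^ (2 ^ℕ suc i)) * (x ^ (2 ^ℕ suc i))         ≡⟨ sym (x^2^[1+i]≡[x^2^i]² (suc i) x) ⟩
    x ^ (2 ^ℕ suc (suc i))                          ∎

  trSum-x²+x : ∀ i x → trSum i ((x ^ 2) + x) ≡ (x ^ (2 ^ℕ i)) + x
  trSum-x²+x zero x = sym (trans (cong (_+ x) (*-identityʳ x)) (x+x≡0 x))
  trSum-x²+x (suc i) x = begin
    trSum i ((x ^ 2) + x) + ((x ^ 2) + x) ^ (2 ^ℕ i)            ≡⟨ cong₂ _+_ (trSum-x²+x i x) (frobenius-+ i (x ^ 2) x) ⟩
    ((x ^ (2 ^ℕ i)) + x) + ((x ^ 2) ^ (2 ^ℕ i) + x ^ (2 ^ℕ i))  ≡⟨ cong (λ t → ((x ^ (2 ^ℕ i)) + x) + (t + x ^ (2 ^ℕ i))) ([x²]^2^i≡x^2^[1+i] i x) ⟩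
    (xᵢ + x) + (x ^ (2 ^ℕ suc i) + xᵢ)                          ≡⟨ telescope xᵢ (x ^ (2 ^ℕ suc i)) x ⟩
    x ^ (2 ^ℕ suc i) + x                                        ∎
    where
    xᵢ = x ^ (2 ^ℕ i)
    telescope : ∀ a b c → (a + c) + (b + a) ≡ b + c
    telescope = solve 3 (λ a b c → (a :+ c) :+ (b :+ a) := b :+ c) refl

  Tr[x²+x]≡0 : ∀ x → Tr ((x ^ 2) + x) ≡ 0#
  Tr[x²+x]≡0 x = trans (trSum-x²+x n x) (trans (cong (_+ x) (x^q≡x x)) (x+x≡0 x))

  Root : (F → F) → F → Set
  Root f x = f x ≡ 0#

  roots-cong : ∀ {f g k} → (∀ x → f x ≡ g x) → AtMost k (Root g) → AtMost k (Root f)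
  roots-cong f≗g = atMost-mono λ x fx≡0 → trans (sym (f≗g x)) fx≡0

  roots-* : ∀ {f g k m} → AtMost k (Root f) → AtMost m (Root g) → AtMost (k ℕ.+ m) (Root λ x → f x * g x)
  roots-* roots-f roots-g = atMost-mono (λ x → x*y≡0⇒x≡0⊎y≡0 _ _) (atMost-⊎ roots-f roots-g)

  roots-id : AtMost 1 (Root λ x → x)
  roots-id = atMost-≡ 0#

  roots-+ : ∀ b → AtMost 1 (Root (_+ b))
  roots-+ b = atMost-mono (λ x → x+y≡0⇒x≡y) (atMost-≡ b)

  roots-linear : ∀ {a} b → a ≢ 0# → AtMost 1 (Root λ x → a * x + b)
  roots-linear {a} b a≢0 = atMost-mono (λ x ax+b≡0 → begin
      x                ≡⟨ sym (x⁻¹*[x*y]≡y a≢0 x) ⟩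
      (a ⁻¹) * (a * x) ≡⟨ cong ((a ⁻¹) *_) (x+y≡0⇒x≡y ax+b≡0) ⟩
      (a ⁻¹) * b       ∎)
    (atMost-≡ ((a ⁻¹) * b))

  roots-quadratic : ∀ a b → AtMost 2 (Root λ x → x * x + a * x + b)
  roots-quadratic a b = atMost-2 (_+ a) (λ x → (x * x + a * x + b) ≟ 0#) λ x y x-root y-root →
      [ inj₁ ∘ sym ∘ x+y≡0⇒x≡y , inj₂ ∘ y≡x+a ]′
        (x*y≡0⇒x≡0⊎y≡0 _ _ (trans (sym (sum-of-values x y)) (trans (cong₂ _+_ x-root y-root) (+-identityˡ 0#))))
    where
    sum-of-values : ∀ x y → (x * x + a * x + b) + (y * y + a * y + b) ≡ (x + y) * ((x + y) + a)
    sum-of-values x y = solve 4 (λ x y a b → (x :* x :+ a :* x :+ b) :+ (y :* y :+ a :* y :+ b)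
                                           := (x :+ y) :* ((x :+ y) :+ a)) refl x y a b
    y≡x+a : ∀ {x y} → (x + y) + a ≡ 0# → y ≡ x + a
    y≡x+a {x} {y} x+y+a≡0 = begin
      y                            ≡⟨ solve 3 (λ x y a → y := ((x :+ y) :+ a) :+ (x :+ a)) refl x y a ⟩
      ((x + y) + a) + (x + a)      ≡⟨ cong (_+ (x + a)) x+y+a≡0 ⟩
      0# + (x + a)                 ≡⟨ +-identityˡ _ ⟩
      x + a                        ∎

  module _ {β : F} (β≢0 : β ≢ 0#) where

    r₀-roots : AtMost 10 (Root (r₀ β))
    r₀-roots = roots-* (roots-* (roots-* (roots-* z⁴-z z-β) quadratic₁) quadratic₂) linear
      where
      z⁴-z : AtMost 4 (Root λ z → (z ^ 4) - z)
      z⁴-z = roots-cong (λ z → trans (cong ((z ^ 4) +_) (-x≡x z)) (z⁴+z≡z[z+1][z²+z+1] z))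
        (roots-* (roots-* roots-id (roots-+ 1#)) (roots-quadratic 1# 1#))

      z-β : AtMost 1 (Root λ z → z - β)
      z-β = roots-cong (λ z → cong (z +_) (-x≡x β)) (roots-+ β)

      quadratic₁ : AtMost 2 (Root λ z → (z ^ 2) + z * (β ^ 2) + z * β + 1#)
      quadratic₁ = roots-cong (λ z → solve 2 (λ z b →
          (z :^ 2) :+ z :* (b :^ 2) :+ z :* b :+ con 1 := z :* z :+ ((b :^ 2) :+ b) :* z :+ con 1) refl z β)
        (roots-quadratic _ _)

      quadratic₂ : AtMost 2 (Root λ z → (z ^ 2) + z * (β ^ 3) + z * (β ^ 2) + z * β + (β ^ 3) + (β ^ 2) + 1#)
      quadratic₂ = roots-cong (λ z → solve 2 (λ z b →
          (z :^ 2) :+ z :* (b :^ 3) :+ z :* (b :^ 2) :+ z :* b :+ (b :^ 3) :+ (b :^ 2) :+ con 1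
          := z :* z :+ ((b :^ 3) :+ (b :^ 2) :+ b) :* z :+ ((b :^ 3) :+ (b :^ 2) :+ con 1)) refl z β)
        (roots-quadratic _ _)

      linear : AtMost 1 (Root λ z → z * (β ^ 3) + β + 1#)
      linear = roots-cong (λ z → solve 2 (λ z b →
          z :* (b :^ 3) :+ b :+ con 1 := (b :^ 3) :* z :+ (b :+ con 1)) refl z β)
        (roots-linear _ (^-≢0 β≢0 3))

    C : F
    C = ((β ^ 3) + (β ^ 2) + 1#) * ((β ⁻¹) ^ 4)

    u : F → F
    u s = s * s + s + C

    u-fibre : ∀ v → AtMost 2 (λ s → u s ≡ v)
    u-fibre v = atMost-mono (λ s us≡v → begin
        s * s + 1# * s + (C + v)   ≡⟨ solve 3 (λ s c v → s :* s :+ con 1 :* s :+ (c :+ v) := (s :* s :+ s :+ c) :+ v) refl s C v ⟩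
        u s + v                    ≡⟨ cong (_+ v) us≡v ⟩
        v + v                      ≡⟨ x+x≡0 v ⟩
        0#                         ∎)
      (roots-quadratic 1# (C + v))

    w : F → F
    w s = (β ⁻¹) * u s + s

    Excluded : F → Set
    Excluded v = v ≡ 0# ⊎ r₀ β (v ⁻¹) ≡ 0#

    excluded-atMost : AtMost 11 Excluded
    excluded-atMost = atMost-mono excluded⇒ (atMost-⊎ (atMost-≡ 0#) (atMost-image _⁻¹ r₀-roots))
      where
      excluded⇒ : ∀ v → Excluded v → v ≡ 0# ⊎ ∃ λ z → r₀ β z ≡ 0# × v ≡ z ⁻¹
      excluded⇒ v (inj₁ v≡0) = inj₁ v≡0
      excluded⇒ v (inj₂ root) with v ≟ 0#
      ... | yes v≡0 = inj₁ v≡0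
      ... | no v≢0 = inj₂ (v ⁻¹ , root , sym (⁻¹-involutive v≢0))

    -- The ring solver knows nothing of inverses, so z²β⁴(w² + w) is matched as a polynomial
    -- identity in which the products z·u s and β·β⁻¹, both 1 when z = 1/u s, stay as ε and γ.
    module _ (z s : F) where
      private
        c = (β ^ 3) + (β ^ 2) + 1#

      Φ : F → F → F
      Φ ε γ = (β ^ 2) * ((ε * ε) * (γ * γ)) + (β ^ 3) * z * ε * γ + (β ^ 4) * z * ε + c * (z ^ 2) * (γ ^ 4)

      [z²β⁴][w²+w]≡Φ : ((z ^ 2) * (β ^ 4)) * ((w s ^ 2) + w s) ≡ Φ (z * u s) (β * (β ⁻¹))
      [z²β⁴][w²+w]≡Φ = solve 4 (λ b b' z s →
        let c = (b :^ 3) :+ (b :^ 2) :+ con 1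
            u = s :* s :+ s :+ c :* (b' :^ 4)
            w = (b' :* u) :+ s
            ε = z :* u
            γ = b :* b'
        in ((z :^ 2) :* (b :^ 4)) :* ((w :^ 2) :+ w)
           := (b :^ 2) :* ((ε :* ε) :* (γ :* γ)) :+ (b :^ 3) :* z :* ε :* γ :+ (b :^ 4) :* z :* ε :+ c :* (z :^ 2) :* (γ :^ 4))
        refl β (β ⁻¹) z s

      Φ-1-1 : Φ 1# 1# ≡ (z * (β ^ 3) + z * (β ^ 2) + z + β) * (z + β)
      Φ-1-1 = solve 2 (λ b z →
        let c = (b :^ 3) :+ (b :^ 2) :+ con 1
        in (b :^ 2) :* ((con 1 :* con 1) :* (con 1 :* con 1)) :+ (b :^ 3) :* z :* con 1 :* con 1
           :+ (b :^ 4) :* z :* con 1 :+ c :* (z :^ 2) :* (con 1 :^ 4)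
           := (z :* (b :^ 3) :+ z :* (b :^ 2) :+ z :+ b) :* (z :+ b)) refl β z

    trArg-u⁻¹ : ∀ s → u s ≢ 0# → trArg β ((u s) ⁻¹) ≡ (w s ^ 2) + w s
    trArg-u⁻¹ s us≢0 = begin
      N * (D ⁻¹)          ≡⟨ cong (_* (D ⁻¹)) (sym D*W≡N) ⟩
      (D * W) * (D ⁻¹)    ≡⟨ *-comm _ _ ⟩
      (D ⁻¹) * (D * W)    ≡⟨ x⁻¹*[x*y]≡y D≢0 W ⟩
      W                   ∎
      where
      z = (u s) ⁻¹
      D = (z ^ 2) * (β ^ 4)
      W = (w s ^ 2) + w s
      N = (z * (β ^ 3) + z * (β ^ 2) + z + β) * (z + β)
      D≢0 : D ≢ 0#
      D≢0 = *-≢0 (^-≢0 (⁻¹-≢0 us≢0) 2) (^-≢0 β≢0 4)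
      D*W≡N : D * W ≡ N
      D*W≡N = begin
        D * W                                ≡⟨ [z²β⁴][w²+w]≡Φ z s ⟩
        Φ z s (z * u s) (β * (β ⁻¹))         ≡⟨ cong₂ (Φ z s) (x⁻¹*x≡1 us≢0) (inverse β β≢0) ⟩
        Φ z s 1# 1#                          ≡⟨ Φ-1-1 z s ⟩
        N                                    ∎

    u⁻¹∈Δ₀ : ∀ s → ¬ Excluded (u s) → InΔ₀ β ((u s) ⁻¹)
    u⁻¹∈Δ₀ s not-excluded =
      trans (cong Tr (trArg-u⁻¹ s (not-excluded ∘ inj₁))) (Tr[x²+x]≡0 (w s)) ,
      not-excluded ∘ inj₂

    Δ₀-nonempty : 22 < q → ∃ (InΔ₀ β)
    Δ₀-nonempty 22<q =
      let s , not-excluded = atMost⇒∃¬ (atMost-preimage u u-fibre excluded-atMost) 22<q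
      in (u s) ⁻¹ , u⁻¹∈Δ₀ s not-excluded

lemmaA3 : (n : ℕ) → 6 ≤ n → (K : FiniteField2 n) →
    (β : FiniteField2.F K) → ¬ (β ≡ FiniteField2.0# K) →
    Σ (FiniteField2.F K) (λ z → FiniteField2.InΔ₀ K β z)
lemmaA3 n 6≤n K β β≢0 = FieldProperties.Δ₀-nonempty K β≢0 22<2^n
  where
  22<2^n : 22 < 2 ^ℕ n
  22<2^n = ℕ.≤-trans (ℕ.m≤m+n 23 41) (ℕ.^-monoʳ-≤ 2 6≤n)
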